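{- Let $\mathcal{M}=\mathcal{M}(\Sigma,I)$ be a trace monoid, $X$ a finite nonempty set with a right action $X\times\mathcal{M}\to X$, and $(f_\alpha)_{\alpha\in X}$ a fibred valuation. For each $\alpha$, let $h_\alpha:\mathscr{C}\to\mathbb{R}$ be the Möbius transform of $f_\alpha|_{\mathscr{C}}$ and $g_\alpha(\gamma)=\sum_{\gamma'\in\mathfrak{C}:\gamma\to\gamma'}h_\alpha(\gamma')$ for $\gamma\in\mathfrak{C}$. Assume $h_\alpha(1)=0$ for all $\alpha\in X$. Then for all $\beta\in X$ and $\gamma\in\mathfrak{C}$, with $\alpha=\beta\cdot\gamma$, one has $f_\beta(\gamma)g_\alpha(\gamma)=h_\beta(\gamma)$.
   Context: Trace monoid: $\Sigma$ finite, $|\Sigma|\ge2$, $I$ irreflexive symmetric, $\mathcal{M}=\Sigma^*/\langle ab=ba,(a,b)\in I\rangle$, unit $1$, length $|x|$. Cliques: traces $a_1\cdots a_k$ ($k\ge0$) of pairwise distinct letters pairwise in $I$, identified with subsets of $\Sigma$ and ordered by inclusion; $\mathscr{C}$ the cliques, $\mathfrak{C}=\mathscr{C}\setminus\{1\}$; $c\to c'$ iff every $b\in c'$ has $a\in c$ with $(a,b)\notin I$. Möbius transform of $f:\mathscr{C}\to\mathbb{R}$: $h(c)=\sum_{c'\in\mathscr{C}:c'\ge c}(-1)^{|c'|-|c|}f(c')$. A fibred valuation is a family of maps $f_\alpha:\mathcal{M}\to\mathbb{R}$ with $f_\alpha(1)=1$ and $f_\alpha(x\cdot y)=f_\alpha(x)f_{\alpha\cdot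 x}(y)$. -}

module Defs where

open import Level using (Level; _⊔_)
open import Data.Bool using (Bool; true; false; _∧_; _∨_; not)
open import Data.Nat using (ℕ; zero; suc; _∸_)
open import Data.Fin using (Fin; _≟_)
open import Data.Fin.Subset using (Subset; ∣_∣)
open import Data.Vec using (Vec; []; _∷_; lookup)
open import Data.List using (List; []; _∷_; _++_; map; filterᵇ; allFin; foldr)
open import Data.Bool.ListAction using (all; any)
open import Relation.Nullary.Decidable using (⌊_⌋)
open import Relation.Binary.PropositionalEquality using (_≡_)
open import Algebra.Bundles using (CommutativeRing)

record Independence (n : ℕ) : Set where
  field
    I      : Fin n → Fin n → Bool
    irrefl : ∀ a → I a a ≡ false
    symm   : ∀ a b → I a b ≡ I b a
open Independence public

Word : ℕ → Set
Word n = List (Fin n)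

-- The trace monoid M(Σ,I) is Word n modulo this relation.
data TraceEq {n : ℕ} (Ind : Independence n) : Word n → Word n → Set where
  t-refl  : ∀ {u} → TraceEq Ind u u
  t-sym   : ∀ {u v} → TraceEq Ind u v → TraceEq Ind v u
  t-trans : ∀ {u v w} → TraceEq Ind u v → TraceEq Ind v w → TraceEq Ind u w
  t-swap  : ∀ u v a b → I Ind a b ≡ true →
            TraceEq Ind (u ++ (a ∷ b ∷ v)) (u ++ (b ∷ a ∷ v))

-- A right action X × M → X of the trace monoid on X = Fin (suc k)
-- (a finite nonempty set), presented on representative words.
record RightAction {n : ℕ} (Ind : Independence n) (k : ℕ) : Set where
  field
    act     : Fin (suc k) → Word n → Fin (suc k)
    act-resp : ∀ α {u v} → TraceEq Ind u v → act α u ≡ act α v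
    act-one : ∀ α → act α [] ≡ α
    act-mul : ∀ α u v → act α (u ++ v) ≡ act (act α u) v
open RightAction public

record FibredValuation {c ℓ : Level} (R : CommutativeRing c ℓ) {n : ℕ}
       (Ind : Independence n) {k : ℕ} (A : RightAction Ind k) : Set (c ⊔ ℓ) where
  open CommutativeRing R
  field
    val      : Fin (suc k) → Word n → Carrier
    val-resp : ∀ α {u v} → TraceEq Ind u v → val α u ≈ val α v
    val-one  : ∀ α → val α [] ≈ 1#
    val-mul  : ∀ α u v → val α (u ++ v) ≈ val α u * val (act A α u) v
open FibredValuation public

allSubsets : ∀ n → List (Subset n)
allSubsets zero    = [] ∷ []
allSubsets (suc n) = map (false ∷_) (allSubsets n) ++ map (true ∷_) (allSubsets n)

module _ {n : ℕ} (Ind : Independence n) where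

  isClique : Subset n → Bool
  isClique c = all (λ a → all (λ b →
      not (lookup c a ∧ lookup c b) ∨ (⌊ a ≟ b ⌋ ∨ I Ind a b)) (allFin n)) (allFin n)

  subsetᵇ : Subset n → Subset n → Bool
  subsetᵇ c c' = all (λ a → not (lookup c a) ∨ lookup c' a) (allFin n)

  nonempty : Subset n → Bool
  nonempty c = any (λ a → lookup c a) (allFin n)

  arrow : Subset n → Subset n → Bool
  arrow c c' = all (λ b → not (lookup c' b) ∨
                 any (λ a → lookup c a ∧ not (I Ind a b)) (allFin n)) (allFin n)

  -- The trace a₁⋯a_k associated with a clique (a representative word).
  word : Subset n → Word n
  word c = filterᵇ (lookup c) (allFin n)

  cliques : List (Subset n)
  cliques = filterᵇ isClique (allSubsets n)

module Mobius {c ℓ : Level} (R : CommutativeRing c ℓ) {n : ℕ}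
       (Ind : Independence n) {k : ℕ} (A : RightAction Ind k)
       (F : FibredValuation R Ind A) where
  open CommutativeRing R

  sumR : List Carrier → Carrier
  sumR = foldr _+_ 0#

  sign : ℕ → Carrier
  sign zero    = 1#
  sign (suc j) = - sign j

  fC : Fin (suc k) → Subset n → Carrier
  fC α γ = val F α (word Ind γ)

  h : Fin (suc k) → Subset n → Carrier
  h α γ = sumR (map (λ γ' → sign (∣ γ' ∣ ∸ ∣ γ ∣) * fC α γ')
                    (filterᵇ (subsetᵇ Ind γ) (cliques Ind)))

  g : Fin (suc k) → Subset n → Carrier
  g α γ = sumR (map (h α)
                    (filterᵇ (λ γ' → nonempty Ind γ' ∧ arrow Ind γ γ') (cliques Ind)))

-- Let D(γ) be the set of letters that depend on some letter of γ; then γ → c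
-- iff c ⊆ D(γ), and γ ⊆ D(γ) by irreflexivity. The cliques containing a clique γ
-- are exactly the γ ∪ δ with δ a clique avoiding D(γ); the letters of such a δ
-- commute with those of γ, so γ ∪ δ = γ · δ as traces and the fibred valuation
-- splits: h_β(γ) = f_β(γ) Z_α(D(γ)), where Z_α(D) is the signed sum of
-- (-1)^|δ| f_α(δ) over the cliques δ avoiding D. On the other side, h_α(1) = 0
-- lets g_α(γ) run over all cliques inside D(γ); exchanging the two sums leaves
-- Σ_{c ⊆ c' ∩ D} (-1)^|c| = [c' ∩ D = ∅], which turns Σ_{c ⊆ D} h_α(c) into
-- Z_α(D) as well.

module Submission where

open import Defs
open import Level using (Level)
open import Algebra.Bundles using (CommutativeRing)
open import Data.Bool using (Bool; true; false; _∧_; _∨_; not; if_then_else_; T; T?)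
open import Data.Bool.Properties using (T-≡; T-∧)
open import Data.Bool.ListAction using (all; any)
open import Data.Empty using (⊥-elim)
open import Data.Fin using (Fin; _≟_)
open import Data.Fin.Subset using (Subset; ⊥; ∁; ∣_∣; _∈_; _⊆_; _∪_)
open import Data.Fin.Subset.Properties
  using (out⊆-⇔; in⊆in-⇔; x∈∁p⇒x∉p; x∉p⇒x∈∁p; x∈p∪q⁻; p⊆p∪q; q⊆p∪q; Empty-unique; p⊆q⇒∣p∣≤∣q∣)
open import Data.List using (List; []; _∷_; _++_; map; foldr; filterᵇ; allFin)
open import Data.List.Membership.Propositional.Properties using (∈-allFin)
open import Data.List.Properties using (++-assoc; filter-≐)
open import Data.List.Relation.Unary.All as All using (All; []; _∷_)
open import Data.List.Relation.Unary.All.Properties using (all⁺; all⁻; all-filter)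
import Data.List.Relation.Unary.Any as Any
open import Data.List.Relation.Unary.Any.Properties using (any⁺; any⁻)
open import Data.Nat using (ℕ; zero; suc; _∸_; _≤_)
import Data.Nat as ℕ
open import Data.Nat.Properties using (+-suc; m∸n+n≡m; m+n∸m≡n)
open import Data.Product using (∃; _×_; _,_; proj₁; proj₂)
open import Data.Product.Function.NonDependent.Propositional using (_×-⇔_)
open import Data.Sum using (_⊎_; inj₁; inj₂)
open import Data.Vec using ([]; _∷_; here; lookup; tabulate)
open import Data.Vec.Properties using ([]=⇒lookup; lookup⇒[]=; lookup∘tabulate; lookup-zipWith)
open import Function using (_∘_; case_of_; _⇔_; mk⇔; Equivalence)
open import Function.Properties.Equivalence using () renaming (trans to ⇔-trans; sym to ⇔-sym)
open import Relation.Binary.PropositionalEquality as ≡ using (_≡_; _≢_; refl; sym; trans; cong; subst)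
open import Relation.Nullary using (¬_; yes; no)
open import Relation.Nullary.Decidable using (⌊_⌋; decidable-stable)

open Equivalence using (to; from)

T-injective : ∀ {x y} → T x ⇔ T y → x ≡ y
T-injective {false} {false} _ = refl
T-injective {false} {true}  e = ⊥-elim (from e _)
T-injective {true}  {false} e = ⊥-elim (to e _)
T-injective {true}  {true}  _ = refl

T-⇒ : ∀ {x y} → T (not x ∨ y) ⇔ (T x → T y)
T-⇒ {false} = mk⇔ (λ _ ()) _
T-⇒ {true}  = mk⇔ (λ t _ → t) (λ f → f _)

T-not : ∀ {x} → T (not x) ⇔ (¬ T x)
T-not {false} = mk⇔ (λ _ ()) _
T-not {true}  = mk⇔ (λ ()) (λ f → f _)

T-all-allFin : ∀ {n} (p : Fin n → Bool) → T (all p (allFin n)) ⇔ (∀ i → T (p i))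
T-all-allFin p = mk⇔ (λ t i → All.lookup (all⁺ p (allFin _) t) (∈-allFin i))
                     (λ f → all⁻ p {xs = allFin _} (All.tabulate (λ {i} _ → f i)))

T-any-allFin : ∀ {n} (p : Fin n → Bool) → T (any p (allFin n)) ⇔ ∃ (T ∘ p)
T-any-allFin p = mk⇔ (λ t → Any.satisfied (any⁻ p (allFin _) t))
                     (λ (i , pi) → any⁺ {xs = allFin _} p (Any.map (λ { refl → pi }) (∈-allFin i)))

∈⇔T-lookup : ∀ {n} {a : Fin n} {p} → a ∈ p ⇔ T (lookup p a)
∈⇔T-lookup {a = a} {p} = mk⇔ (λ a∈p → from T-≡ ([]=⇒lookup a∈p)) (λ t → lookup⇒[]= a p (to T-≡ t))

-- Unlike subsetᵇ, defined by recursion on the vectors, so that sums over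
-- allSubsets (suc n) split on the first letter by computation.
infix 7 _⊆ᵇ_

_⊆ᵇ_ : ∀ {n} → Subset n → Subset n → Bool
[]      ⊆ᵇ []      = true
(x ∷ p) ⊆ᵇ (y ∷ q) = (not x ∨ y) ∧ (p ⊆ᵇ q)

⊆ᵇ⇔⊆ : ∀ {n} {p q : Subset n} → T (p ⊆ᵇ q) ⇔ p ⊆ q
⊆ᵇ⇔⊆ {p = []}        {[]}        = mk⇔ (λ _ {_} ()) _
⊆ᵇ⇔⊆ {p = false ∷ p} {y ∷ q}     = ⇔-trans ⊆ᵇ⇔⊆ out⊆-⇔
⊆ᵇ⇔⊆ {p = true ∷ p}  {true ∷ q}  = ⇔-trans ⊆ᵇ⇔⊆ in⊆in-⇔
⊆ᵇ⇔⊆ {p = true ∷ p}  {false ∷ q} = mk⇔ (λ ()) (λ p⊆q → case p⊆q here of λ ())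

∣p∪q∣≡∣p∣+∣q∣ : ∀ {n} (p q : Subset n) → T (q ⊆ᵇ ∁ p) → ∣ p ∪ q ∣ ≡ ∣ p ∣ ℕ.+ ∣ q ∣
∣p∪q∣≡∣p∣+∣q∣ []          []          _ = refl
∣p∪q∣≡∣p∣+∣q∣ (true ∷ p)  (false ∷ q) t = cong suc (∣p∪q∣≡∣p∣+∣q∣ p q t)
∣p∪q∣≡∣p∣+∣q∣ (false ∷ p) (true ∷ q)  t = trans (cong suc (∣p∪q∣≡∣p∣+∣q∣ p q t)) (sym (+-suc ∣ p ∣ ∣ q ∣))
∣p∪q∣≡∣p∣+∣q∣ (false ∷ p) (false ∷ q) t = ∣p∪q∣≡∣p∣+∣q∣ p q t
∣p∪q∣≡∣p∣+∣q∣ (true ∷ p)  (true ∷ q)  ()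

all-⇒⇔⊆ : ∀ {n} {p q : Subset n} {r : Fin n → Bool} → (∀ a → r a ≡ lookup q a) →
          T (all (λ a → not (lookup p a) ∨ r a) (allFin n)) ⇔ p ⊆ q
all-⇒⇔⊆ r≡q = mk⇔
  (λ t {a} a∈p → from ∈⇔T-lookup (subst T (r≡q a) (to T-⇒ (to (T-all-allFin _) t a) (to ∈⇔T-lookup a∈p))))
  (λ p⊆q → from (T-all-allFin _) λ a → from T-⇒ λ pa →
     subst T (sym (r≡q a)) (to ∈⇔T-lookup (p⊆q (from ∈⇔T-lookup pa))))

module _ {n : ℕ} (Ind : Independence n) where

  TraceEq-++ˡ : ∀ w {u v} → TraceEq Ind u v → TraceEq Ind (w ++ u) (w ++ v)
  TraceEq-++ˡ w t-refl          = t-refl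
  TraceEq-++ˡ w (t-sym t)       = t-sym (TraceEq-++ˡ w t)
  TraceEq-++ˡ w (t-trans t t′)  = t-trans (TraceEq-++ˡ w t) (TraceEq-++ˡ w t′)
  TraceEq-++ˡ w (t-swap u v a b Iab)
    rewrite sym (++-assoc w u (a ∷ b ∷ v)) | sym (++-assoc w u (b ∷ a ∷ v)) =
      t-swap (w ++ u) v a b Iab

  commute-past : ∀ x w z → All (λ b → T (I Ind x b)) w → TraceEq Ind (x ∷ w ++ z) (w ++ x ∷ z)
  commute-past x []      z []           = t-refl
  commute-past x (b ∷ w) z (Ixb ∷ Ixw) =
    t-trans (t-swap [] (w ++ z) x b (to T-≡ Ixb)) (TraceEq-++ˡ (b ∷ []) (commute-past x w z Ixw))

  filterᵇ-∨ : (p q : Fin n → Bool) → (∀ {a b} → T (p a) → T (q b) → T (I Ind a b)) →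
              ∀ xs → TraceEq Ind (filterᵇ (λ x → p x ∨ q x) xs) (filterᵇ p xs ++ filterᵇ q xs)
  filterᵇ-∨ p q p⊥q [] = t-refl
  filterᵇ-∨ p q p⊥q (x ∷ xs) with p x in px | q x in qx
  ... | true  | true  = ⊥-elim (subst T (irrefl Ind x) (p⊥q (from T-≡ px) (from T-≡ qx)))
  ... | true  | false = TraceEq-++ˡ (x ∷ []) (filterᵇ-∨ p q p⊥q xs)
  ... | false | false = filterᵇ-∨ p q p⊥q xs
  ... | false | true  =
    t-trans (TraceEq-++ˡ (x ∷ []) (filterᵇ-∨ p q p⊥q xs))
            (commute-past x (filterᵇ p xs) (filterᵇ q xs)
              (All.map (λ pb → subst T (symm Ind _ x) (p⊥q pb (from T-≡ qx))) (all-filter (T? ∘ p) xs)))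

  IsClique : Subset n → Set
  IsClique c = ∀ {a b} → a ∈ c → b ∈ c → a ≢ b → T (I Ind a b)

  isClique⇔IsClique : ∀ {c} → T (isClique Ind c) ⇔ IsClique c
  isClique⇔IsClique {c} = mk⇔
    (λ t {a} {b} a∈c b∈c → distinct (to T-⇒ (to (T-all-allFin (P a)) (to (T-all-allFin _) t a) b)
                                            (from T-∧ (to ∈⇔T-lookup a∈c , to ∈⇔T-lookup b∈c))))
    (λ cl → from (T-all-allFin _) λ a → from (T-all-allFin (P a)) λ b → from T-⇒ λ ab →
       let a∈c , b∈c = to T-∧ ab in distinct⁻ (cl (from ∈⇔T-lookup a∈c) (from ∈⇔T-lookup b∈c)))
    where
    P : Fin n → Fin n → Bool
    P a b = not (lookup c a ∧ lookup c b) ∨ (⌊ a ≟ b ⌋ ∨ I Ind a b)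
    distinct : ∀ {a b : Fin n} {y} → T (⌊ a ≟ b ⌋ ∨ y) → a ≢ b → T y
    distinct {a} {b} t a≢b with a ≟ b
    ... | yes a≡b = ⊥-elim (a≢b a≡b)
    ... | no _    = t
    distinct⁻ : ∀ {a b : Fin n} {y} → (a ≢ b → T y) → T (⌊ a ≟ b ⌋ ∨ y)
    distinct⁻ {a} {b} f with a ≟ b
    ... | yes _   = _
    ... | no a≢b  = f a≢b

  IsClique-⊆ : ∀ {c c′} → c ⊆ c′ → IsClique c′ → IsClique c
  IsClique-⊆ c⊆c′ cl a∈c b∈c = cl (c⊆c′ a∈c) (c⊆c′ b∈c)

  isClique-⊆ : ∀ {c c′} → T (c ⊆ᵇ c′) → T (isClique Ind c′) → T (isClique Ind c)
  isClique-⊆ {c} {c′} c⊆c′ cl =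
    from isClique⇔IsClique (IsClique-⊆ {c} {c′} (to ⊆ᵇ⇔⊆ c⊆c′) (to (isClique⇔IsClique {c′}) cl))

  dependents : Subset n → Subset n
  dependents γ = tabulate (λ b → any (λ a → lookup γ a ∧ not (I Ind a b)) (allFin n))

  ∈-dependents⇔ : ∀ {γ b} → b ∈ dependents γ ⇔ ∃ λ a → a ∈ γ × ¬ T (I Ind a b)
  ∈-dependents⇔ {γ} {b} = mk⇔
    (λ b∈D → let a , t = to (T-any-allFin _) (subst T (lookup∘tabulate _ b) (to ∈⇔T-lookup b∈D))
                 a∈γ , ¬Iab = to T-∧ t
             in a , from ∈⇔T-lookup a∈γ , to T-not ¬Iab)
    (λ (a , a∈γ , ¬Iab) → from ∈⇔T-lookup (subst T (sym (lookup∘tabulate _ b))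
       (from (T-any-allFin _) (a , from T-∧ (to ∈⇔T-lookup a∈γ , from T-not ¬Iab)))))

  ⊆-dependents : ∀ {γ} → γ ⊆ dependents γ
  ⊆-dependents {x = a} a∈γ = from ∈-dependents⇔ (a , a∈γ , subst T (irrefl Ind a))

  independent-of-∁dependents : ∀ {γ δ a b} → δ ⊆ ∁ (dependents γ) → a ∈ γ → b ∈ δ → T (I Ind a b)
  independent-of-∁dependents δ⊆ a∈γ b∈δ = decidable-stable (T? _) λ ¬Iab →
    x∈∁p⇒x∉p (δ⊆ b∈δ) (from ∈-dependents⇔ (_ , a∈γ , ¬Iab))

  clique-∪⇔ : ∀ {γ δ} → IsClique γ →
              (δ ⊆ ∁ γ × IsClique (γ ∪ δ)) ⇔ (IsClique δ × δ ⊆ ∁ (dependents γ))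
  clique-∪⇔ {γ} {δ} clγ = mk⇔
    (λ (δ⊆∁γ , cl∪) → IsClique-⊆ (q⊆p∪q γ δ) cl∪ , λ {b} b∈δ → x∉p⇒x∈∁p λ b∈D →
       let a , a∈γ , ¬Iab = to ∈-dependents⇔ b∈D
       in ¬Iab (cl∪ (p⊆p∪q δ a∈γ) (q⊆p∪q γ δ b∈δ) λ a≡b → x∈∁p⇒x∉p (δ⊆∁γ b∈δ) (subst (_∈ γ) a≡b a∈γ)))
    (λ (clδ , δ⊆∁D) →
       (λ b∈δ → x∉p⇒x∈∁p λ b∈γ → x∈∁p⇒x∉p (δ⊆∁D b∈δ) (⊆-dependents b∈γ)) ,
       λ a∈ b∈ → cl∪ δ⊆∁D clδ (x∈p∪q⁻ γ δ a∈) (x∈p∪q⁻ γ δ b∈))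
    where
    cl∪ : δ ⊆ ∁ (dependents γ) → IsClique δ → ∀ {a b} → a ∈ γ ⊎ a ∈ δ → b ∈ γ ⊎ b ∈ δ →
          a ≢ b → T (I Ind a b)
    cl∪ _     _   (inj₁ a∈γ) (inj₁ b∈γ) = clγ a∈γ b∈γ
    cl∪ _     clδ (inj₂ a∈δ) (inj₂ b∈δ) = clδ a∈δ b∈δ
    cl∪ δ⊆∁D _   (inj₁ a∈γ) (inj₂ b∈δ) _ = independent-of-∁dependents δ⊆∁D a∈γ b∈δ
    cl∪ δ⊆∁D _   (inj₂ a∈δ) (inj₁ b∈γ) _ =
      subst T (symm Ind _ _) (independent-of-∁dependents δ⊆∁D b∈γ a∈δ)

  clique-∪ᵇ : ∀ {γ δ} → IsClique γ →
              (δ ⊆ᵇ ∁ γ ∧ isClique Ind (γ ∪ δ)) ≡ (isClique Ind δ ∧ δ ⊆ᵇ ∁ (dependents γ))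
  clique-∪ᵇ clγ = T-injective
    (⇔-trans T-∧ (⇔-trans (⊆ᵇ⇔⊆ ×-⇔ isClique⇔IsClique)
      (⇔-trans (clique-∪⇔ clγ) (⇔-sym (⇔-trans T-∧ (isClique⇔IsClique ×-⇔ ⊆ᵇ⇔⊆))))))

  word-∪ : ∀ {γ δ} → δ ⊆ ∁ (dependents γ) →
           TraceEq Ind (word Ind (γ ∪ δ)) (word Ind γ ++ word Ind δ)
  word-∪ {γ} {δ} δ⊆∁D = subst (λ w → TraceEq Ind w (word Ind γ ++ word Ind δ)) (sym word-≡)
    (filterᵇ-∨ (lookup γ) (lookup δ)
      (λ a b → independent-of-∁dependents {γ} {δ} δ⊆∁D (from ∈⇔T-lookup a) (from ∈⇔T-lookup b))
      (allFin n))
    where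
    word-≡ : word Ind (γ ∪ δ) ≡ filterᵇ (λ a → lookup γ a ∨ lookup δ a) (allFin n)
    word-≡ = filter-≐ (T? ∘ lookup (γ ∪ δ)) (T? ∘ λ a → lookup γ a ∨ lookup δ a)
      ((λ {a} → subst T (lookup-zipWith _∨_ a γ δ)) , (λ {a} → subst T (sym (lookup-zipWith _∨_ a γ δ))))
      (allFin n)

  arrow≡⊆ᵇdependents : ∀ γ c → arrow Ind γ c ≡ c ⊆ᵇ dependents γ
  arrow≡⊆ᵇdependents γ c =
    T-injective (⇔-trans (all-⇒⇔⊆ {p = c} λ b → sym (lookup∘tabulate _ b)) (⇔-sym ⊆ᵇ⇔⊆))

  subsetᵇ≡⊆ᵇ : ∀ p q → subsetᵇ Ind p q ≡ p ⊆ᵇ q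
  subsetᵇ≡⊆ᵇ p q = T-injective (⇔-trans (all-⇒⇔⊆ {p = p} {q} λ _ → refl) (⇔-sym ⊆ᵇ⇔⊆))

  nonempty≡false⇒≡⊥ : ∀ {c} → nonempty Ind c ≡ false → c ≡ ⊥
  nonempty≡false⇒≡⊥ {c} e = Empty-unique λ (a , a∈c) →
    subst T e (from (T-any-allFin (lookup c)) (a , to ∈⇔T-lookup a∈c))

module Sums {r ℓ} (R : CommutativeRing r ℓ) where
  open CommutativeRing R renaming (refl to ≈-refl; sym to ≈-sym; trans to ≈-trans)
  open import Algebra.Properties.Ring ring using (-0#≈0#; -‿+-comm; -‿distribˡ-*; -‿distribʳ-*; -‿involutive)
  open import Algebra.Properties.CommutativeSemigroup +-commutativeSemigroup using (interchange)
  open import Relation.Binary.Reasoning.Setoid setoid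

  private variable
    a : Level
    A B : Set a

  ∑ : List A → (A → Carrier) → Carrier
  ∑ xs f = foldr _+_ 0# (map f xs)

  syntax ∑ xs (λ x → e) = ∑[ x ∈ xs ] e

  when : Bool → Carrier → Carrier
  when b x = if b then x else 0#

  sign : ℕ → Carrier
  sign zero    = 1#
  sign (suc j) = - sign j

  ∑-cong : ∀ xs {f g : A → Carrier} → (∀ x → f x ≈ g x) → ∑ xs f ≈ ∑ xs g
  ∑-cong []       f≈g = ≈-refl
  ∑-cong (x ∷ xs) f≈g = +-cong (f≈g x) (∑-cong xs f≈g)

  ∑-++ : ∀ xs ys (f : A → Carrier) → ∑ (xs ++ ys) f ≈ ∑ xs f + ∑ ys f
  ∑-++ []       ys f = ≈-sym (+-identityˡ _)
  ∑-++ (x ∷ xs) ys f = ≈-trans (+-congˡ (∑-++ xs ys f)) (≈-sym (+-assoc _ _ _))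

  ∑-filterᵇ : ∀ p xs (f : A → Carrier) → ∑ (filterᵇ p xs) f ≈ ∑[ x ∈ xs ] when (p x) (f x)
  ∑-filterᵇ p []       f = ≈-refl
  ∑-filterᵇ p (x ∷ xs) f with p x
  ... | true  = +-congˡ (∑-filterᵇ p xs f)
  ... | false = ≈-trans (∑-filterᵇ p xs f) (≈-sym (+-identityˡ _))

  ∑-zero : (xs : List A) → ∑[ x ∈ xs ] 0# ≈ 0#
  ∑-zero []       = ≈-refl
  ∑-zero (x ∷ xs) = ≈-trans (+-congˡ (∑-zero xs)) (+-identityˡ 0#)

  ∑-+ : ∀ xs (f g : A → Carrier) → ∑[ x ∈ xs ] (f x + g x) ≈ ∑ xs f + ∑ xs g
  ∑-+ []       f g = ≈-sym (+-identityˡ 0#)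
  ∑-+ (x ∷ xs) f g = ≈-trans (+-congˡ (∑-+ xs f g)) (interchange _ _ _ _)

  ∑-neg : ∀ xs (f : A → Carrier) → ∑[ x ∈ xs ] (- f x) ≈ - ∑ xs f
  ∑-neg []       f = ≈-sym -0#≈0#
  ∑-neg (x ∷ xs) f = ≈-trans (+-congˡ (∑-neg xs f)) (-‿+-comm _ _)

  ∑-distribˡ : ∀ a xs (f : A → Carrier) → a * ∑ xs f ≈ ∑[ x ∈ xs ] (a * f x)
  ∑-distribˡ a []       f = zeroʳ a
  ∑-distribˡ a (x ∷ xs) f = ≈-trans (distribˡ a _ _) (+-congˡ (∑-distribˡ a xs f))

  when-∑ : ∀ b xs (f : A → Carrier) → when b (∑ xs f) ≈ ∑[ x ∈ xs ] when b (f x)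
  when-∑ true  xs f = ≈-refl
  when-∑ false xs f = ≈-sym (∑-zero xs)

  ∑-map : ∀ xs (g : A → B) (f : B → Carrier) → ∑ (map g xs) f ≡ ∑ xs (f ∘ g)
  ∑-map []       g f = ≡.refl
  ∑-map (x ∷ xs) g f = ≡.cong (f (g x) +_) (∑-map xs g f)

  ∑-comm : ∀ xs ys (f : A → B → Carrier) →
           ∑[ x ∈ xs ] ∑ ys (f x) ≈ ∑[ y ∈ ys ] ∑[ x ∈ xs ] f x y
  ∑-comm []       ys f = ≈-sym (∑-zero ys)
  ∑-comm (x ∷ xs) ys f = ≈-trans (+-congˡ (∑-comm xs ys f)) (≈-sym (∑-+ ys (f x) _))

  when-∧ : ∀ a b x → when (a ∧ b) x ≡ when a (when b x)
  when-∧ true  b x = ≡.refl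
  when-∧ false b x = ≡.refl

  when-comm : ∀ a b x → when a (when b x) ≡ when b (when a x)
  when-comm true  b     x = ≡.refl
  when-comm false true  x = ≡.refl
  when-comm false false x = ≡.refl

  when-≈0 : ∀ b {x} → x ≈ 0# → when b x ≈ 0#
  when-≈0 true  x≈0 = x≈0
  when-≈0 false x≈0 = ≈-refl

  when-cong : ∀ b {x y} → (T b → x ≈ y) → when b x ≈ when b y
  when-cong true  x≈y = x≈y _
  when-cong false x≈y = ≈-refl

  when-neg : ∀ b x → when b (- x) ≈ - when b x
  when-neg true  x = ≈-refl
  when-neg false x = ≈-sym -0#≈0#

  *-when : ∀ x b y → x * when b y ≈ when b (x * y)
  *-when x true  y = ≈-refl
  *-when x false y = zeroʳ x

  sign-+ : ∀ m n → sign (m ℕ.+ n) ≈ sign m * sign n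
  sign-+ zero    n = ≈-sym (*-identityˡ _)
  sign-+ (suc m) n = ≈-trans (-‿cong (sign-+ m n)) (-‿distribˡ-* _ _)

  sign-* : ∀ n → sign n * sign n ≈ 1#
  sign-* zero    = *-identityˡ 1#
  sign-* (suc n) = begin
    - sign n * - sign n   ≈⟨ -‿distribˡ-* _ _ ⟨
    - (sign n * - sign n) ≈⟨ -‿cong (-‿distribʳ-* _ _) ⟨
    - - (sign n * sign n) ≈⟨ -‿involutive _ ⟩
    sign n * sign n       ≈⟨ sign-* n ⟩
    1#                    ∎

  sign-∸ : ∀ {m n} → n ≤ m → sign (m ∸ n) ≈ sign m * sign n
  sign-∸ {m} {n} n≤m = begin
    sign (m ∸ n)                   ≈⟨ *-identityʳ _ ⟨
    sign (m ∸ n) * 1#              ≈⟨ *-congˡ (sign-* n) ⟨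
    sign (m ∸ n) * (sign n * sign n) ≈⟨ *-assoc _ _ _ ⟨
    sign (m ∸ n) * sign n * sign n   ≈⟨ *-congʳ (sign-+ (m ∸ n) n) ⟨
    sign (m ∸ n ℕ.+ n) * sign n       ≡⟨ ≡.cong (λ k → sign k * sign n) (m∸n+n≡m n≤m) ⟩
    sign m * sign n                  ∎

  ∑-allSubsets-suc : ∀ n (f : Subset (suc n) → Carrier) →
    ∑ (allSubsets (suc n)) f ≈ ∑[ c ∈ allSubsets n ] f (false ∷ c) + ∑[ c ∈ allSubsets n ] f (true ∷ c)
  ∑-allSubsets-suc n f = ≈-trans (∑-++ (map (false ∷_) (allSubsets n)) _ f)
    (+-cong (reflexive (∑-map (allSubsets n) (false ∷_) f)) (reflexive (∑-map (allSubsets n) (true ∷_) f)))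

  ∑-⊇ : ∀ {n} (γ : Subset n) (f : Subset n → Carrier) →
        ∑[ c ∈ allSubsets n ] when (γ ⊆ᵇ c) (f c) ≈ ∑[ δ ∈ allSubsets n ] when (δ ⊆ᵇ ∁ γ) (f (γ ∪ δ))
  ∑-⊇ []           f = ≈-refl
  ∑-⊇ {suc n} (false ∷ γ) f = begin
    _ ≈⟨ ∑-allSubsets-suc n _ ⟩
    _ ≈⟨ +-cong (∑-⊇ γ (f ∘ (false ∷_))) (∑-⊇ γ (f ∘ (true ∷_))) ⟩
    _ ≈⟨ ∑-allSubsets-suc n _ ⟨
    _ ∎
  ∑-⊇ {suc n} (true ∷ γ) f = begin
    _                            ≈⟨ ∑-allSubsets-suc n _ ⟩
    ∑[ c ∈ allSubsets n ] 0# + _ ≈⟨ +-cong (∑-zero (allSubsets n)) (∑-⊇ γ (f ∘ (true ∷_))) ⟩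
    0# + X                       ≈⟨ +-comm _ _ ⟩
    X + 0#                       ≈⟨ +-congˡ (∑-zero (allSubsets n)) ⟨
    X + ∑[ c ∈ allSubsets n ] 0# ≈⟨ ∑-allSubsets-suc n _ ⟨
    _                            ∎
    where X = ∑[ δ ∈ allSubsets n ] when (δ ⊆ᵇ ∁ γ) (f (true ∷ γ ∪ δ))

  ∑-alternating : ∀ {n} (s t : Subset n) →
    ∑[ c ∈ allSubsets n ] when (c ⊆ᵇ s) (when (c ⊆ᵇ t) (sign ∣ c ∣)) ≈ when (s ⊆ᵇ ∁ t) 1#
  ∑-alternating []      []      = +-identityʳ 1#
  ∑-alternating {suc n} (x ∷ s) (y ∷ t) = ≈-trans (∑-allSubsets-suc n _) (split x y)
    where
    S = ∑[ c ∈ allSubsets n ] when (c ⊆ᵇ s) (when (c ⊆ᵇ t) (sign ∣ c ∣))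
    S+0 : S + ∑[ c ∈ allSubsets n ] 0# ≈ when (s ⊆ᵇ ∁ t) 1#
    S+0 = ≈-trans (+-congˡ (∑-zero (allSubsets n))) (≈-trans (+-identityʳ S) (∑-alternating s t))
    split : ∀ x y → S + ∑[ c ∈ allSubsets n ] when (x ∧ c ⊆ᵇ s) (when (y ∧ c ⊆ᵇ t) (- sign ∣ c ∣))
                    ≈ when ((not x ∨ not y) ∧ s ⊆ᵇ ∁ t) 1#
    split true true = begin
      S + ∑[ c ∈ allSubsets n ] when (c ⊆ᵇ s) (when (c ⊆ᵇ t) (- sign ∣ c ∣))
        ≈⟨ +-congˡ (∑-cong (allSubsets n) λ c →
             ≈-trans (when-cong (c ⊆ᵇ s) λ _ → when-neg (c ⊆ᵇ t) _) (when-neg (c ⊆ᵇ s) _)) ⟩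
      S + ∑[ c ∈ allSubsets n ] (- when (c ⊆ᵇ s) (when (c ⊆ᵇ t) (sign ∣ c ∣)))
        ≈⟨ +-congˡ (∑-neg (allSubsets n) _) ⟩
      S - S ≈⟨ -‿inverseʳ S ⟩
      0# ∎
    split true  false = ≈-trans (+-congˡ (∑-cong (allSubsets n) λ c → when-≈0 (c ⊆ᵇ s) ≈-refl)) S+0
    split false y     = S+0

module _ {r ℓ} (R : CommutativeRing r ℓ) {n : ℕ} (Ind : Independence n)
         {k : ℕ} (A : RightAction Ind k) (F : FibredValuation R Ind A) where
  open CommutativeRing R renaming (refl to ≈-refl; sym to ≈-sym; trans to ≈-trans)
  open import Algebra.Properties.CommutativeSemigroup *-commutativeSemigroup using (x∙yz≈y∙xz; xy∙z≈xz∙y)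
  open import Relation.Binary.Reasoning.Setoid setoid
  open Sums R
  open Mobius R Ind A F using (fC; h; g)

  Mobius-sign≡sign : ∀ j → Mobius.sign R Ind A F j ≡ sign j
  Mobius-sign≡sign zero    = ≡.refl
  Mobius-sign≡sign (suc j) = ≡.cong -_ (Mobius-sign≡sign j)

  signedSumAvoiding : Fin (suc k) → Subset n → Carrier
  signedSumAvoiding α D =
    ∑[ δ ∈ allSubsets n ] when (isClique Ind δ) (when (δ ⊆ᵇ ∁ D) (sign ∣ δ ∣ * fC α δ))

  h-as-sum : ∀ α c → h α c ≈
    ∑[ c′ ∈ allSubsets n ] when (c ⊆ᵇ c′) (when (isClique Ind c′) (sign (∣ c′ ∣ ∸ ∣ c ∣) * fC α c′))
  h-as-sum α c = begin
    h α c                                           ≈⟨ ∑-filterᵇ (subsetᵇ Ind c) (cliques Ind) _ ⟩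
    ∑[ c′ ∈ cliques Ind ] when (subsetᵇ Ind c c′) _ ≈⟨ ∑-filterᵇ (isClique Ind) (allSubsets n) _ ⟩
    _                                               ≈⟨ ∑-cong (allSubsets n) (reflexive ∘ reorder) ⟩
    _                                               ∎
    where
    reorder : ∀ c′ → when (isClique Ind c′) (when (subsetᵇ Ind c c′) (Mobius.sign R Ind A F (∣ c′ ∣ ∸ ∣ c ∣) * fC α c′))
                   ≡ when (c ⊆ᵇ c′) (when (isClique Ind c′) (sign (∣ c′ ∣ ∸ ∣ c ∣) * fC α c′))
    reorder c′ = ≡.trans (when-comm (isClique Ind c′) (subsetᵇ Ind c c′) _)
      (≡.cong₂ (λ b s → when b (when (isClique Ind c′) (s * fC α c′)))
               (subsetᵇ≡⊆ᵇ Ind c c′) (Mobius-sign≡sign (∣ c′ ∣ ∸ ∣ c ∣)))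

  fC-∪ : ∀ β {γ δ} → δ ⊆ ∁ (dependents Ind γ) →
         fC β (γ ∪ δ) ≈ fC β γ * fC (act A β (word Ind γ)) δ
  fC-∪ β {γ} {δ} δ⊆∁D = ≈-trans (val-resp F β (word-∪ Ind {γ} {δ} δ⊆∁D)) (val-mul F β _ _)

  h-factorises : ∀ β γ → IsClique Ind γ →
    h β γ ≈ fC β γ * signedSumAvoiding (act A β (word Ind γ)) (dependents Ind γ)
  h-factorises β γ clγ = begin
    h β γ
      ≈⟨ h-as-sum β γ ⟩
    ∑[ c ∈ allSubsets n ] when (γ ⊆ᵇ c) (when (isClique Ind c) (X c))
      ≈⟨ ∑-⊇ γ _ ⟩
    ∑[ δ ∈ allSubsets n ] when (δ ⊆ᵇ ∁ γ) (when (isClique Ind (γ ∪ δ)) (X (γ ∪ δ)))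
      ≈⟨ ∑-cong (allSubsets n) term ⟩
    ∑[ δ ∈ allSubsets n ] (fC β γ * when (isClique Ind δ) (when (δ ⊆ᵇ ∁ D) (sign ∣ δ ∣ * fC α δ)))
      ≈⟨ ∑-distribˡ (fC β γ) (allSubsets n) _ ⟨
    fC β γ * signedSumAvoiding α D
      ∎
    where
    α = act A β (word Ind γ)
    D = dependents Ind γ
    X : Subset n → Carrier
    X c = sign (∣ c ∣ ∸ ∣ γ ∣) * fC β c
    term : ∀ δ → when (δ ⊆ᵇ ∁ γ) (when (isClique Ind (γ ∪ δ)) (X (γ ∪ δ)))
               ≈ fC β γ * when (isClique Ind δ) (when (δ ⊆ᵇ ∁ D) (sign ∣ δ ∣ * fC α δ))
    term δ = begin
      when (δ ⊆ᵇ ∁ γ) (when (isClique Ind (γ ∪ δ)) (X (γ ∪ δ))) ≡⟨ when-∧ (δ ⊆ᵇ ∁ γ) _ _ ⟨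
      when (δ ⊆ᵇ ∁ γ ∧ isClique Ind (γ ∪ δ)) (X (γ ∪ δ))       ≈⟨ when-cong _ factor ⟩
      when (δ ⊆ᵇ ∁ γ ∧ isClique Ind (γ ∪ δ)) (fC β γ * Y)     ≡⟨ ≡.cong (λ b → when b (fC β γ * Y)) clique-∪ ⟩
      when (isClique Ind δ ∧ δ ⊆ᵇ ∁ D) (fC β γ * Y)           ≈⟨ *-when (fC β γ) _ Y ⟨
      fC β γ * when (isClique Ind δ ∧ δ ⊆ᵇ ∁ D) Y             ≡⟨ ≡.cong (fC β γ *_) (when-∧ (isClique Ind δ) _ Y) ⟩
      fC β γ * when (isClique Ind δ) (when (δ ⊆ᵇ ∁ D) Y)      ∎
      where
      Y = sign ∣ δ ∣ * fC α δ
      clique-∪ = clique-∪ᵇ Ind {γ} {δ} clγ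
      factor : T (δ ⊆ᵇ ∁ γ ∧ isClique Ind (γ ∪ δ)) → X (γ ∪ δ) ≈ fC β γ * Y
      factor t = begin
        sign (∣ γ ∪ δ ∣ ∸ ∣ γ ∣) * fC β (γ ∪ δ) ≡⟨ ≡.cong (λ j → sign j * fC β (γ ∪ δ)) ∣γ∪δ∣∸∣γ∣ ⟩
        sign ∣ δ ∣ * fC β (γ ∪ δ)              ≈⟨ *-congˡ (fC-∪ β {γ} {δ} δ⊆∁D) ⟩
        sign ∣ δ ∣ * (fC β γ * fC α δ)         ≈⟨ x∙yz≈y∙xz _ _ _ ⟩
        fC β γ * Y                             ∎
        where
        ∣γ∪δ∣∸∣γ∣ : ∣ γ ∪ δ ∣ ∸ ∣ γ ∣ ≡ ∣ δ ∣
        ∣γ∪δ∣∸∣γ∣ = ≡.trans (≡.cong (_∸ ∣ γ ∣) (∣p∪q∣≡∣p∣+∣q∣ γ δ (proj₁ (to T-∧ t))))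
                            (m+n∸m≡n ∣ γ ∣ ∣ δ ∣)
        δ⊆∁D : δ ⊆ ∁ D
        δ⊆∁D = to ⊆ᵇ⇔⊆ (proj₂ (to T-∧ (≡.subst T clique-∪ t)))

  ∑-h-⊆ : ∀ α D →
    ∑[ c ∈ allSubsets n ] when (c ⊆ᵇ D) (when (isClique Ind c) (h α c)) ≈ signedSumAvoiding α D
  ∑-h-⊆ α D = begin
    ∑[ c ∈ 𝒫 ] when (c ⊆ᵇ D) (when (isClique Ind c) (h α c))
      ≈⟨ ∑-cong 𝒫 (λ c → when-cong (c ⊆ᵇ D) λ _ → when-cong (isClique Ind c) λ _ → h-as-sum α c) ⟩
    ∑[ c ∈ 𝒫 ] when (c ⊆ᵇ D) (when (isClique Ind c) (∑ 𝒫 (Y c)))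
      ≈⟨ ∑-cong 𝒫 (λ c → ≈-trans (when-cong (c ⊆ᵇ D) λ _ → when-∑ (isClique Ind c) 𝒫 (Y c))
                                 (when-∑ (c ⊆ᵇ D) 𝒫 _)) ⟩
    ∑[ c ∈ 𝒫 ] ∑[ c′ ∈ 𝒫 ] when (c ⊆ᵇ D) (when (isClique Ind c) (Y c c′))
      ≈⟨ ∑-cong 𝒫 (λ c → ∑-cong 𝒫 (separate c)) ⟩
    ∑[ c ∈ 𝒫 ] ∑[ c′ ∈ 𝒫 ] (K c′ * when (c ⊆ᵇ c′) (when (c ⊆ᵇ D) (sign ∣ c ∣)))
      ≈⟨ ∑-comm 𝒫 𝒫 _ ⟩
    ∑[ c′ ∈ 𝒫 ] ∑[ c ∈ 𝒫 ] (K c′ * when (c ⊆ᵇ c′) (when (c ⊆ᵇ D) (sign ∣ c ∣)))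
      ≈⟨ ∑-cong 𝒫 (λ c′ → ∑-distribˡ (K c′) 𝒫 _) ⟨
    ∑[ c′ ∈ 𝒫 ] (K c′ * ∑[ c ∈ 𝒫 ] when (c ⊆ᵇ c′) (when (c ⊆ᵇ D) (sign ∣ c ∣)))
      ≈⟨ ∑-cong 𝒫 (λ c′ → *-congˡ (∑-alternating c′ D)) ⟩
    ∑[ c′ ∈ 𝒫 ] (K c′ * when (c′ ⊆ᵇ ∁ D) 1#)
      ≈⟨ ∑-cong 𝒫 (λ c′ → ≈-trans (*-when (K c′) (c′ ⊆ᵇ ∁ D) 1#)
                          (≈-trans (when-cong (c′ ⊆ᵇ ∁ D) λ _ → *-identityʳ (K c′))
                                   (reflexive (when-comm (c′ ⊆ᵇ ∁ D) (isClique Ind c′) _)))) ⟩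
    signedSumAvoiding α D ∎
    where
    𝒫 = allSubsets n
    Y : Subset n → Subset n → Carrier
    Y c c′ = when (c ⊆ᵇ c′) (when (isClique Ind c′) (sign (∣ c′ ∣ ∸ ∣ c ∣) * fC α c′))
    K : Subset n → Carrier
    K c′ = when (isClique Ind c′) (sign ∣ c′ ∣ * fC α c′)
    separate : ∀ c c′ → when (c ⊆ᵇ D) (when (isClique Ind c) (Y c c′))
                        ≈ K c′ * when (c ⊆ᵇ c′) (when (c ⊆ᵇ D) (sign ∣ c ∣))
    separate c c′ with c ⊆ᵇ c′ in c⊆c′ | isClique Ind c′ in clc′
    ... | false | _     = ≈-trans (when-≈0 (c ⊆ᵇ D) (when-≈0 (isClique Ind c) ≈-refl)) (≈-sym (zeroʳ _))
    ... | true  | false = ≈-trans (when-≈0 (c ⊆ᵇ D) (when-≈0 (isClique Ind c) ≈-refl)) (≈-sym (zeroˡ _))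
    ... | true  | true  rewrite to T-≡ (isClique-⊆ Ind {c} {c′} (from T-≡ c⊆c′) (from T-≡ clc′))
                        with c ⊆ᵇ D
    ...   | false = ≈-sym (zeroʳ _)
    ...   | true  = begin
      sign (∣ c′ ∣ ∸ ∣ c ∣) * fC α c′    ≈⟨ *-congʳ (sign-∸ (p⊆q⇒∣p∣≤∣q∣ (to (⊆ᵇ⇔⊆ {p = c}) (from T-≡ c⊆c′)))) ⟩
      sign ∣ c′ ∣ * sign ∣ c ∣ * fC α c′ ≈⟨ xy∙z≈xz∙y _ _ _ ⟩
      sign ∣ c′ ∣ * fC α c′ * sign ∣ c ∣ ∎

  g-as-sum : (∀ α → h α ⊥ ≈ 0#) → ∀ α γ →
    g α γ ≈ ∑[ c ∈ allSubsets n ] when (c ⊆ᵇ dependents Ind γ) (when (isClique Ind c) (h α c))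
  g-as-sum h⊥≈0 α γ = begin
    g α γ                                              ≈⟨ ∑-filterᵇ _ (cliques Ind) (h α) ⟩
    ∑[ c ∈ cliques Ind ] when (nonempty Ind c ∧ arrow Ind γ c) (h α c)
                                                       ≈⟨ ∑-filterᵇ (isClique Ind) (allSubsets n) _ ⟩
    _                                                  ≈⟨ ∑-cong (allSubsets n) drop-nonempty ⟩
    _                                                  ∎
    where
    drop-nonempty : ∀ c → when (isClique Ind c) (when (nonempty Ind c ∧ arrow Ind γ c) (h α c))
                          ≈ when (c ⊆ᵇ dependents Ind γ) (when (isClique Ind c) (h α c))
    drop-nonempty c with nonempty Ind c in ne
    ... | true  = reflexive (≡.trans (when-comm (isClique Ind c) (arrow Ind γ c) (h α c))
                    (≡.cong (λ b → when b (when (isClique Ind c) (h α c))) (arrow≡⊆ᵇdependents Ind γ c)))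
    ... | false = ≈-trans (when-≈0 (isClique Ind c) ≈-refl)
                    (≈-sym (when-≈0 (c ⊆ᵇ dependents Ind γ) (when-≈0 (isClique Ind c) hc≈0)))
      where
      hc≈0 : h α c ≈ 0#
      hc≈0 = ≡.subst (λ c → h α c ≈ 0#) (≡.sym (nonempty≡false⇒≡⊥ Ind {c} ne)) (h⊥≈0 α)

lemma2 : ∀ {c ℓ : Level} (R : CommutativeRing c ℓ) (n : ℕ) → 2 ≤ n →
    (Ind : Independence n) (k : ℕ) (A : RightAction Ind k)
    (F : FibredValuation R Ind A) →
    (∀ α → CommutativeRing._≈_ R (Mobius.h R Ind A F α ⊥) (CommutativeRing.0# R)) →
    ∀ (β : Fin (suc k)) (γ : Subset n) →
    isClique Ind γ ≡ true → nonempty Ind γ ≡ true →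
    CommutativeRing._≈_ R
      (CommutativeRing._*_ R (val F β (word Ind γ))
        (Mobius.g R Ind A F (act A β (word Ind γ)) γ))
      (Mobius.h R Ind A F β γ)
lemma2 R n _ Ind k A F h⊥≈0 β γ clγ _ = begin
  fC β γ * g α γ                   ≈⟨ *-congˡ (g-as-sum R Ind A F h⊥≈0 α γ) ⟩
  fC β γ * _                       ≈⟨ *-congˡ (∑-h-⊆ R Ind A F α (dependents Ind γ)) ⟩
  fC β γ * signedSumAvoiding R Ind A F α (dependents Ind γ)
                                   ≈⟨ h-factorises R Ind A F β γ (to (isClique⇔IsClique Ind {γ}) (from T-≡ clγ)) ⟨
  h β γ                            ∎
  where
  open CommutativeRing R
  open import Relation.Binary.Reasoning.Setoid setoid
  open Mobius R Ind A F using (fC; g; h)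
  α = act A β (word Ind γ)
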